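{- Every bipartite TRVG on $n$ vertices has at most $2n-2$ edges. Moreover, this bound is best possible for $n\ge 7$: for every $n\ge 7$ there exists a bipartite TRVG on $n$ vertices with exactly $2n-2$ edges.
   Context: A graph $G$ is a transparent rectangle visibility graph (TRVG) if there is a collection of rectangles in the plane with sides parallel to the coordinate axes and pairwise disjoint interiors, one rectangle $R_v$ for each vertex $v$, such that for distinct vertices $u,v$: $u$ and $v$ are adjacent if and only if there is a horizontal or a vertical line meeting the interiors of both $R_u$ and $R_v$ (other rectangles in between do not block visibility).
   Formalization: The rectangles representing a TRVG have rational corner coordinates. -}

module Defs where

open import Data.Nat using (ℕ; _+_; _<ᵇ_)
open import Data.Fin using (Fin; toℕ)
open import Data.Bool using (Bool; true; false; if_then_else_; _∧_)
open import Data.List using (List; map; allFin)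
open import Data.Nat.ListAction using (sum)
open import Data.Rational using (ℚ; _<_)
open import Data.Product using (Σ; _×_; ∃)
open import Data.Sum using (_⊎_)
open import Relation.Nullary using (¬_)
open import Relation.Binary.PropositionalEquality using (_≡_; _≢_)
open import Function.Bundles using (_⇔_)

record Graph (n : ℕ) : Set where
  field
    adj    : Fin n → Fin n → Bool
    sym    : ∀ i j → adj i j ≡ adj j i
    irrefl : ∀ i → adj i i ≡ false
open Graph public

edgeCount : ∀ {n} → Graph n → ℕ
edgeCount {n} G =
  sum (map (λ i → sum (map (λ j →
        if (toℕ i <ᵇ toℕ j) ∧ adj G i j then 1 else 0) (allFin n))) (allFin n))

Bipartite : ∀ {n} → Graph n → Set
Bipartite {n} G = Σ (Fin n → Bool) λ c → ∀ i j → adj G i j ≡ true → c i ≢ c j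

record Rect : Set where
  field
    x₁ x₂ y₁ y₂ : ℚ
    x₁<x₂ : x₁ < x₂
    y₁<y₂ : y₁ < y₂
open Rect public

-- Open intervals (x₁,x₂) of the two rectangles meet: some vertical line
-- meets both interiors.
XOverlap : Rect → Rect → Set
XOverlap R S = (x₁ R < x₂ S) × (x₁ S < x₂ R)

-- Open intervals (y₁,y₂) meet: some horizontal line meets both interiors.
YOverlap : Rect → Rect → Set
YOverlap R S = (y₁ R < y₂ S) × (y₁ S < y₂ R)

InteriorDisjoint : Rect → Rect → Set
InteriorDisjoint R S = ¬ (XOverlap R S × YOverlap R S)

Visible : Rect → Rect → Set
Visible R S = YOverlap R S ⊎ XOverlap R S

IsTRVG : ∀ {n} → Graph n → Set
IsTRVG {n} G = Σ (Fin n → Rect) λ R →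
  (∀ i j → i ≢ j → InteriorDisjoint (R i) (R j)) ×
  (∀ i j → i ≢ j → (adj G i j ≡ true) ⇔ Visible (R i) (R j))

{-# OPTIONS --safe #-}
module Submission where

-- A bipartite graph has no triangles. Rectangles seeing each other along a vertical line are
-- exactly the pairs whose x-intervals overlap, and a triangle-free overlap graph of intervals
-- is a forest: if the intervals are ordered by right endpoint, an interval overlapping two
-- later ones forces these two to overlap, so every interval overlaps at most one later
-- interval and the last one none. The same holds for y-intervals, giving 2(n - 1) edges.
-- For n = 7 + k the bound is attained by seven boxes whose x- and y-overlap graphs are two
-- edge-disjoint spanning trees, plus k unit squares on the diagonal, each seen by one long box
-- in each direction; by the upper bound it suffices to count 2n - 2 edges from below.

open import Data.Bool using (Bool; true; false; if_then_else_; T; _∧_; _∨_; not)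
import Data.Bool.Properties as Bool
open import Data.Empty using (⊥; ⊥-elim)
open import Data.Fin as Fin using (Fin; zero; suc; toℕ; _↑ˡ_; _↑ʳ_; punchIn)
open import Data.Fin.Induction using (spo-noetherian)
open import Data.Fin.Patterns using (0F; 1F; 2F; 3F; 4F; 5F; 6F)
import Data.Fin.Properties as Fin
import Data.Integer as ℤ
import Data.Integer.Properties as ℤ
open import Data.List using (map; tabulate; allFin)
open import Data.Nat as ℕ using (ℕ; zero; suc; _+_; _*_; _∸_; _≤_; _<ᵇ_; z≤n; s≤s)
import Data.Nat.ListAction as List
open import Data.Nat.Properties
  using (+-0-commutativeMonoid; +-mono-≤; +-identityʳ; ≤-reflexive; ≤-trans; ≤-antisym;
         m≤m+n; m≤n+m; n<1+n; m<1+n⇒m≤n; <ᵇ⇒<; <⇒<ᵇ; *-cancelˡ-≡; *-distribˡ-+;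
         *-distribˡ-∸; m+[n∸m]≡n; module ≤-Reasoning)
open import Algebra.Properties.CommutativeMonoid.Sum +-0-commutativeMonoid
  using (sum; sum-syntax; ∑-comm; ∑-distrib-+; sum-cong-≗; sum-remove; sum-replicate-zero)
open import Data.Product using (Σ; ∃; _×_; _,_; proj₁; proj₂)
open import Data.Product.Function.NonDependent.Propositional using (_×-⇔_)
open import Data.Rational as ℚ using (ℚ)
open import Data.Rational.Literals using (fromℤ)
import Data.Rational.Properties as ℚ
open import Data.Sum as ⊎ using (_⊎_; inj₁; inj₂; [_,_])
open import Data.Sum.Function.Propositional using (_⊎-⇔_)
open import Data.Vec.Functional using (removeAt)
open import Defs hiding (sym)
open import Function using (_∘_; flip; id)
open import Function.Bundles using (_⇔_; mk⇔; Equivalence)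
import Function.Properties.Equivalence as ⇔
open import Induction.WellFounded using (Acc; acc)
open import Level using (Level; 0ℓ)
open import Relation.Binary
  using (Rel; Decidable; Symmetric; Transitive; Trichotomous; Tri; tri<; tri≈; tri>;
         IsStrictTotalOrder; IsDecStrictPartialOrder; isStrictTotalOrderᶜ)
open import Relation.Binary.PropositionalEquality
  using (_≡_; _≢_; refl; sym; trans; cong; cong₂; subst; subst₂; isEquivalence;
         module ≡-Reasoning)
open import Relation.Nullary using (¬_; Dec; yes; no; does; ¬?; _×-dec_; T?)
open import Relation.Nullary.Decidable using (dec-true; dec-false; does-⇔; from-yes; _→-dec_)
open import Relation.Unary as U using (Pred)

private
  variable
    ℓ ℓ′ ℓ₁ ℓ₂ : Level
    n : ℕ

𝟙 : Bool → ℕ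
𝟙 b = if b then 1 else 0

sum-map-tabulate : ∀ {A : Set} (f : A → ℕ) (g : Fin n → A) →
                   List.sum (map f (tabulate g)) ≡ ∑[ i < n ] f (g i)
sum-map-tabulate {zero}  f g = refl
sum-map-tabulate {suc n} f g = cong (f (g zero) +_) (sum-map-tabulate f (g ∘ suc))

∑-mono-≤ : {f g : Fin n → ℕ} → (∀ i → f i ≤ g i) → ∑[ i < n ] f i ≤ ∑[ i < n ] g i
∑-mono-≤ {zero}  f≤g = z≤n
∑-mono-≤ {suc n} f≤g = +-mono-≤ (f≤g zero) (∑-mono-≤ (f≤g ∘ suc))

∑≤n : {f : Fin n → ℕ} → (∀ i → f i ≤ 1) → ∑[ i < n ] f i ≤ n
∑≤n {zero}  f≤1 = z≤n
∑≤n {suc n} f≤1 = +-mono-≤ (f≤1 zero) (∑≤n (f≤1 ∘ suc))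

∑≤n∸1 : {f : Fin n → ℕ} → (∀ i → f i ≤ 1) → (Fin n → ∃ λ m → f m ≡ 0) →
        ∑[ i < n ] f i ≤ n ∸ 1
∑≤n∸1 {zero}      f≤1 vanishes = z≤n
∑≤n∸1 {suc n} {f} f≤1 vanishes with vanishes zero
... | m , fm≡0 = begin
  ∑[ i < suc n ] f i        ≡⟨ sum-remove {i = m} f ⟩
  f m + sum (removeAt f m)  ≡⟨ cong (_+ sum (removeAt f m)) fm≡0 ⟩
  sum (removeAt f m)        ≤⟨ ∑≤n (f≤1 ∘ punchIn m) ⟩
  n                         ∎
  where open ≤-Reasoning

∑𝟙≡0 : {P : Pred (Fin n) ℓ} (P? : U.Decidable P) → (∀ i → ¬ P i) →
       ∑[ i < n ] 𝟙 (does (P? i)) ≡ 0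
∑𝟙≡0 {n} P? ∄P = trans (sum-cong-≗ (λ i → cong 𝟙 (dec-false (P? i) (∄P i))))
                       (sum-replicate-zero n)

∑𝟙≡n : {P : Pred (Fin n) ℓ} (P? : U.Decidable P) → (∀ i → P i) →
       ∑[ i < n ] 𝟙 (does (P? i)) ≡ n
∑𝟙≡n {zero}  P? ∀P = refl
∑𝟙≡n {suc n} P? ∀P =
  cong₂ _+_ (cong 𝟙 (dec-true (P? zero) (∀P zero))) (∑𝟙≡n (P? ∘ suc) (∀P ∘ suc))

∑𝟙≤1 : {P : Pred (Fin n) ℓ} (P? : U.Decidable P) → (∀ {i j} → P i → P j → i ≡ j) →
       ∑[ i < n ] 𝟙 (does (P? i)) ≤ 1
∑𝟙≤1 {zero}  P? unique = z≤n
∑𝟙≤1 {suc n} P? unique with P? zero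
... | yes P0 = s≤s (≤-reflexive (∑𝟙≡0 (P? ∘ suc) (λ i Pi → Fin.0≢1+n (unique P0 Pi))))
... | no  _  = ∑𝟙≤1 (P? ∘ suc) (λ Pi Pj → Fin.suc-injective (unique Pi Pj))

𝟙-yes : {A : Set ℓ} (a? : Dec A) → A → ∀ b → 𝟙 (does a? ∧ b) ≡ 𝟙 b
𝟙-yes a? a b = cong (λ x → 𝟙 (x ∧ b)) (dec-true a? a)

𝟙-no : {A : Set ℓ} (a? : Dec A) → ¬ A → ∀ b → 𝟙 (does a? ∧ b) ≡ 0
𝟙-no a? ¬a b = cong (λ x → 𝟙 (x ∧ b)) (dec-false a? ¬a)

𝟙-⊆-∪ : {A B C : Set ℓ} (a? : Dec A) (b? : Dec B) (c? : Dec C) → (A → B ⊎ C) →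
        𝟙 (does a?) ≤ 𝟙 (does b?) + 𝟙 (does c?)
𝟙-⊆-∪ (no _)  b? c? split = z≤n
𝟙-⊆-∪ (yes a) b? c? split with split a
... | inj₁ b = ≤-trans (≤-reflexive (cong 𝟙 (sym (dec-true b? b)))) (m≤m+n _ _)
... | inj₂ c = ≤-trans (≤-reflexive (cong 𝟙 (sym (dec-true c? c)))) (m≤n+m _ _)

pairCount : {P : Rel (Fin n) ℓ} → Decidable P → ℕ
pairCount {n} P? = ∑[ i < n ] ∑[ j < n ] 𝟙 (does (P? i j))

pairCount-⊆-∪ : {P Q S : Rel (Fin n) ℓ} (P? : Decidable P) (Q? : Decidable Q) (S? : Decidable S) →
                (∀ {i j} → P i j → Q i j ⊎ S i j) → pairCount P? ≤ pairCount Q? + pairCount S?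
pairCount-⊆-∪ {n} P? Q? S? split = begin
  pairCount P?
    ≤⟨ ∑-mono-≤ (λ i → ∑-mono-≤ (λ j → 𝟙-⊆-∪ (P? i j) (Q? i j) (S? i j) split)) ⟩
  ∑[ i < n ] ∑[ j < n ] (𝟙 (does (Q? i j)) + 𝟙 (does (S? i j)))
    ≡⟨ sum-cong-≗ (λ i → ∑-distrib-+ (λ j → 𝟙 (does (Q? i j))) _) ⟩
  ∑[ i < n ] (∑[ j < n ] 𝟙 (does (Q? i j)) + ∑[ j < n ] 𝟙 (does (S? i j)))
    ≡⟨ ∑-distrib-+ (λ i → ∑[ j < n ] 𝟙 (does (Q? i j))) _ ⟩
  pairCount Q? + pairCount S? ∎
  where open ≤-Reasoning

module _ {_<_ : Rel (Fin n) ℓ} (sto : IsStrictTotalOrder _≡_ _<_) where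
  open IsStrictTotalOrder sto using (compare; _<?_)

  pairCount-oriented : {P : Rel (Fin n) ℓ′} (P? : Decidable P) → Symmetric P →
    2 * pairCount (λ i j → i <? j ×-dec P? i j) ≡ pairCount (λ i j → ¬? (i Fin.≟ j) ×-dec P? i j)
  pairCount-oriented P? P-sym = begin
    2 * ∑∑ A                               ≡⟨ cong (∑∑ A +_) (+-identityʳ (∑∑ A)) ⟩
    ∑∑ A + ∑∑ A                            ≡⟨ cong (∑∑ A +_) (∑-comm A) ⟩
    ∑∑ A + ∑[ i < n ] ∑[ j < n ] A j i     ≡⟨ ∑-distrib-+ (λ i → ∑[ j < n ] A i j) _ ⟨
    ∑[ i < n ] (∑[ j < n ] A i j + ∑[ j < n ] A j i)
      ≡⟨ sum-cong-≗ (λ i → ∑-distrib-+ (A i) (flip A i)) ⟨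
    ∑[ i < n ] ∑[ j < n ] (A i j + A j i)
      ≡⟨ sum-cong-≗ (λ i → sum-cong-≗ (λ j → entry i j (compare i j))) ⟩
    pairCount (λ i j → ¬? (i Fin.≟ j) ×-dec P? i j) ∎
    where
    open ≡-Reasoning
    A : Fin n → Fin n → ℕ
    A i j = 𝟙 (does (i <? j ×-dec P? i j))
    ∑∑ : (Fin n → Fin n → ℕ) → ℕ
    ∑∑ f = ∑[ i < n ] ∑[ j < n ] f i j
    entry : ∀ i j → Tri (i < j) (i ≡ j) (j < i) →
            A i j + A j i ≡ 𝟙 (does (¬? (i Fin.≟ j) ×-dec P? i j))
    entry i j (tri< i<j i≢j j≮i) = begin
      A i j + A j i          ≡⟨ cong₂ _+_ (𝟙-yes (i <? j) i<j _) (𝟙-no (j <? i) j≮i _) ⟩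
      𝟙 (does (P? i j)) + 0  ≡⟨ +-identityʳ _ ⟩
      𝟙 (does (P? i j))      ≡⟨ 𝟙-yes (¬? (i Fin.≟ j)) i≢j _ ⟨
      _                      ∎
    entry i .i (tri≈ i≮i refl _) = begin
      A i i + A i i  ≡⟨ cong₂ _+_ (𝟙-no (i <? i) i≮i _) (𝟙-no (i <? i) i≮i _) ⟩
      0              ≡⟨ 𝟙-no (¬? (i Fin.≟ i)) (λ i≢i → i≢i refl) _ ⟨
      _              ∎
    entry i j (tri> i≮j i≢j j<i) = begin
      A i j + A j i      ≡⟨ cong₂ _+_ (𝟙-no (i <? j) i≮j _) (𝟙-yes (j <? i) j<i _) ⟩
      𝟙 (does (P? j i))  ≡⟨ cong 𝟙 (does-⇔ (mk⇔ P-sym P-sym) (P? j i) (P? i j)) ⟩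
      𝟙 (does (P? i j))  ≡⟨ 𝟙-yes (¬? (i Fin.≟ j)) i≢j _ ⟨
      _                  ∎

module _ {_<₁_ : Rel (Fin n) ℓ₁} {_<₂_ : Rel (Fin n) ℓ₂}
         (sto₁ : IsStrictTotalOrder _≡_ _<₁_) (sto₂ : IsStrictTotalOrder _≡_ _<₂_) where
  private
    module O₁ = IsStrictTotalOrder sto₁
    module O₂ = IsStrictTotalOrder sto₂

  pairCount-orderIndependent : {P : Rel (Fin n) ℓ′} (P? : Decidable P) → Symmetric P →
    pairCount (λ i j → i O₁.<? j ×-dec P? i j) ≡ pairCount (λ i j → i O₂.<? j ×-dec P? i j)
  pairCount-orderIndependent P? P-sym = *-cancelˡ-≡ _ _ 2
    (trans (pairCount-oriented sto₁ P? P-sym) (sym (pairCount-oriented sto₂ P? P-sym)))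

module _ {_≺_ : Rel (Fin n) ℓ} (dspo : IsDecStrictPartialOrder _≡_ _≺_) where
  open IsDecStrictPartialOrder dspo using (isStrictPartialOrder; _<?_)

  maximal : Fin n → ∃ λ m → ∀ j → ¬ m ≺ j
  maximal i = climb (spo-noetherian isStrictPartialOrder i)
    where
    climb : ∀ {i} → Acc (flip _≺_) i → ∃ λ m → ∀ j → ¬ m ≺ j
    climb {i} (acc above) with Fin.any? (i <?_)
    ... | yes (j , i≺j) = climb (above i≺j)
    ... | no  ∄j        = i , λ j i≺j → ∄j (j , i≺j)

TriangleFree : {A : Set} → Rel A ℓ → Set ℓ
TriangleFree E = ∀ {i j k} → i ≢ j → j ≢ k → i ≢ k → E i j → E j k → E i k → ⊥

module IntervalOverlaps (l r : Fin n → ℚ) where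

  Overlap : Rel (Fin n) 0ℓ
  Overlap i j = l i ℚ.< r j × l j ℚ.< r i

  overlap? : Decidable Overlap
  overlap? i j = l i ℚ.<? r j ×-dec l j ℚ.<? r i

  overlap-sym : Symmetric Overlap
  overlap-sym (li<rj , lj<ri) = lj<ri , li<rj

  _≺_ : Rel (Fin n) 0ℓ
  i ≺ j = r i ℚ.< r j ⊎ (r i ≡ r j × i Fin.< j)

  ≺⇒r≤r : ∀ {i j} → i ≺ j → r i ℚ.≤ r j
  ≺⇒r≤r (inj₁ ri<rj)       = ℚ.<⇒≤ ri<rj
  ≺⇒r≤r (inj₂ (ri≡rj , _)) = ℚ.≤-reflexive ri≡rj

  ≺-irrefl : ∀ {i} → ¬ i ≺ i
  ≺-irrefl (inj₁ ri<ri)     = ℚ.<-irrefl refl ri<ri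
  ≺-irrefl (inj₂ (_ , i<i)) = Fin.<-irrefl refl i<i

  ≺⇒≢ : ∀ {i j} → i ≺ j → i ≢ j
  ≺⇒≢ i≺i refl = ≺-irrefl i≺i

  ≺-trans : Transitive _≺_
  ≺-trans (inj₁ ri<rj)         j≺k                  = inj₁ (ℚ.<-≤-trans ri<rj (≺⇒r≤r j≺k))
  ≺-trans (inj₂ (ri≡rj , _))   (inj₁ rj<rk)         = inj₁ (ℚ.≤-<-trans (ℚ.≤-reflexive ri≡rj) rj<rk)
  ≺-trans (inj₂ (ri≡rj , i<j)) (inj₂ (rj≡rk , j<k)) = inj₂ (trans ri≡rj rj≡rk , Fin.<-trans i<j j<k)

  ≺⇒tri : ∀ {i j} → i ≺ j → Tri (i ≺ j) (i ≡ j) (j ≺ i)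
  ≺⇒tri i≺j = tri< i≺j (≺⇒≢ i≺j) (≺-irrefl ∘ ≺-trans i≺j)

  ≻⇒tri : ∀ {i j} → j ≺ i → Tri (i ≺ j) (i ≡ j) (j ≺ i)
  ≻⇒tri j≺i = tri> (≺-irrefl ∘ ≺-trans j≺i) (≺⇒≢ j≺i ∘ sym) j≺i

  ≺-compare : Trichotomous _≡_ _≺_
  ≺-compare i j with ℚ.<-cmp (r i) (r j) | Fin.<-cmp i j
  ... | tri< ri<rj _ _ | _             = ≺⇒tri (inj₁ ri<rj)
  ... | tri> _ _ rj<ri | _             = ≻⇒tri (inj₁ rj<ri)
  ... | tri≈ _ ri≡rj _ | tri< i<j _ _  = ≺⇒tri (inj₂ (ri≡rj , i<j))
  ... | tri≈ _ _ _     | tri≈ _ refl _ = tri≈ ≺-irrefl refl ≺-irrefl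
  ... | tri≈ _ ri≡rj _ | tri> _ _ j<i  = ≻⇒tri (inj₂ (sym ri≡rj , j<i))

  ≺-isStrictTotalOrder : IsStrictTotalOrder _≡_ _≺_
  ≺-isStrictTotalOrder = isStrictTotalOrderᶜ record
    { isEquivalence = isEquivalence ; trans = ≺-trans ; compare = ≺-compare }

  open IsStrictTotalOrder ≺-isStrictTotalOrder
    using (isDecStrictPartialOrder) renaming (_<?_ to _≺?_)

  later-overlaps : ∀ {i j k} → i ≺ j → i ≺ k → Overlap i j → Overlap i k → Overlap j k
  later-overlaps i≺j i≺k (_ , lj<ri) (_ , lk<ri) =
    ℚ.<-≤-trans lj<ri (≺⇒r≤r i≺k) , ℚ.<-≤-trans lk<ri (≺⇒r≤r i≺j)

  module _ (triangleFree : TriangleFree Overlap) where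

    laterOverlaps≤1 : ∀ i → ∑[ j < n ] 𝟙 (does (i ≺? j ×-dec overlap? i j)) ≤ 1
    laterOverlaps≤1 i = ∑𝟙≤1 (λ j → i ≺? j ×-dec overlap? i j) unique
      where
      unique : ∀ {j k} → i ≺ j × Overlap i j → i ≺ k × Overlap i k → j ≡ k
      unique {j} {k} (i≺j , Oij) (i≺k , Oik) with j Fin.≟ k
      ... | yes j≡k = j≡k
      ... | no  j≢k = ⊥-elim (triangleFree (≺⇒≢ i≺j) j≢k (≺⇒≢ i≺k)
                                           Oij (later-overlaps i≺j i≺k Oij Oik) Oik)

    orderedOverlaps≤n∸1 : {_<_ : Rel (Fin n) ℓ} (sto : IsStrictTotalOrder _≡_ _<_) →
      pairCount (λ i j → IsStrictTotalOrder._<?_ sto i j ×-dec overlap? i j) ≤ n ∸ 1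
    orderedOverlaps≤n∸1 sto = begin
      pairCount (λ i j → IsStrictTotalOrder._<?_ sto i j ×-dec overlap? i j)
        ≡⟨ pairCount-orderIndependent sto ≺-isStrictTotalOrder overlap? overlap-sym ⟩
      pairCount (λ i j → i ≺? j ×-dec overlap? i j)
        ≤⟨ ∑≤n∸1 laterOverlaps≤1 lastRowEmpty ⟩
      n ∸ 1 ∎
      where
      open ≤-Reasoning
      lastRowEmpty : Fin n → ∃ λ m → ∑[ j < n ] 𝟙 (does (m ≺? j ×-dec overlap? m j)) ≡ 0
      lastRowEmpty i with maximal isDecStrictPartialOrder i
      ... | m , m-maximal =
        m , ∑𝟙≡0 (λ j → m ≺? j ×-dec overlap? m j) (λ j → m-maximal j ∘ proj₁)

edgeCount≡pairCount : (G : Graph n) →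
  edgeCount G ≡ pairCount (λ i j → T? ((toℕ i <ᵇ toℕ j) ∧ adj G i j))
edgeCount≡pairCount {n} G =
  trans (sum-map-tabulate (λ i → List.sum (map (e i) (allFin n))) id)
        (sum-cong-≗ (λ i → sum-map-tabulate (e i) id))
  where
  e : Fin n → Fin n → ℕ
  e i j = 𝟙 ((toℕ i <ᵇ toℕ j) ∧ adj G i j)

bipartite⇒triangleFree : {G : Graph n} → Bipartite G → TriangleFree (λ i j → adj G i j ≡ true)
bipartite⇒triangleFree (colour , proper) _ _ _ Eij Ejk Eik =
  proper _ _ Eik (trans (Bool.¬-not (proper _ _ Eij))
                 (trans (cong not (Bool.¬-not (proper _ _ Ejk))) (Bool.not-involutive _)))

n∸1+n∸1≡2n∸2 : ∀ n → (n ∸ 1) + (n ∸ 1) ≡ 2 * n ∸ 2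
n∸1+n∸1≡2n∸2 n = trans (cong ((n ∸ 1) +_) (sym (+-identityʳ (n ∸ 1)))) (*-distribˡ-∸ 2 n 1)

bipartiteTRVG-edgeCount≤ : (G : Graph n) → IsTRVG G → Bipartite G → edgeCount G ≤ 2 * n ∸ 2
bipartiteTRVG-edgeCount≤ {n} G (R , _ , adj⇔visible) bipartite = begin
  edgeCount G
    ≡⟨ edgeCount≡pairCount G ⟩
  pairCount (λ i j → T? ((toℕ i <ᵇ toℕ j) ∧ adj G i j))
    ≤⟨ pairCount-⊆-∪ (λ i j → T? ((toℕ i <ᵇ toℕ j) ∧ adj G i j)) Y-ordered X-ordered edge⇒overlap ⟩
  pairCount Y-ordered + pairCount X-ordered
    ≤⟨ +-mono-≤ (Y.orderedOverlaps≤n∸1 (overlapTriangleFree inj₁) Fin.<-isStrictTotalOrder)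
                (X.orderedOverlaps≤n∸1 (overlapTriangleFree inj₂) Fin.<-isStrictTotalOrder) ⟩
  (n ∸ 1) + (n ∸ 1)
    ≡⟨ n∸1+n∸1≡2n∸2 n ⟩
  2 * n ∸ 2 ∎
  where
  open ≤-Reasoning
  open IsStrictTotalOrder (Fin.<-isStrictTotalOrder {n}) using (_<?_)
  module X = IntervalOverlaps (x₁ ∘ R) (x₂ ∘ R)
  module Y = IntervalOverlaps (y₁ ∘ R) (y₂ ∘ R)

  X-ordered : Decidable (λ i j → i Fin.< j × X.Overlap i j)
  X-ordered i j = i <? j ×-dec X.overlap? i j
  Y-ordered : Decidable (λ i j → i Fin.< j × Y.Overlap i j)
  Y-ordered i j = i <? j ×-dec Y.overlap? i j

  overlapTriangleFree : {O : Rel (Fin n) 0ℓ} → (∀ {i j} → O i j → Visible (R i) (R j)) →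
                        TriangleFree O
  overlapTriangleFree visible i≢j j≢k i≢k Oij Ojk Oik =
    bipartite⇒triangleFree {G = G} bipartite i≢j j≢k i≢k
      (edge i≢j (visible Oij)) (edge j≢k (visible Ojk)) (edge i≢k (visible Oik))
    where
    edge : ∀ {i j} → i ≢ j → Visible (R i) (R j) → adj G i j ≡ true
    edge i≢j = Equivalence.from (adj⇔visible _ _ i≢j)

  edge⇒overlap : ∀ {i j} → T ((toℕ i <ᵇ toℕ j) ∧ adj G i j) →
                 (i Fin.< j × Y.Overlap i j) ⊎ (i Fin.< j × X.Overlap i j)
  edge⇒overlap {i} {j} i<j∧ij with Equivalence.to Bool.T-∧ i<j∧ij
  ... | i<ᵇj , ij = ⊎.map (i<j ,_) (i<j ,_)
                      (Equivalence.to (adj⇔visible i j (Fin.<⇒≢ i<j)) (Equivalence.to Bool.T-≡ ij))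
    where
    i<j : i Fin.< j
    i<j = <ᵇ⇒< (toℕ i) (toℕ j) i<ᵇj

fromℕ : ℕ → ℚ
fromℕ m = fromℤ (ℤ.+ m)

fromℕ-<⇔ : ∀ {m n} → m ℕ.< n ⇔ fromℕ m ℚ.< fromℕ n
fromℕ-<⇔ {m} {n} = mk⇔
  (λ m<n → ℚ.*<* (subst₂ ℤ._<_ (sym (ℤ.*-identityʳ (ℤ.+ m))) (sym (ℤ.*-identityʳ (ℤ.+ n)))
                                (ℤ.+<+ m<n)))
  (λ { (ℚ.*<* m<n) → ℤ.drop‿+<+ (subst₂ ℤ._<_ (ℤ.*-identityʳ (ℤ.+ m)) (ℤ.*-identityʳ (ℤ.+ n))
                                               m<n) })

-- Integer coordinates and Boolean overlap tests let the checks on the explicit configuration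
-- below run by evaluation.
overlapsᵇ : (a₁ a₂ b₁ b₂ : ℕ) → Bool
overlapsᵇ a₁ a₂ b₁ b₂ = (a₁ <ᵇ b₂) ∧ (b₁ <ᵇ a₂)

overlapsᵇ-comm : ∀ a₁ a₂ b₁ b₂ → overlapsᵇ a₁ a₂ b₁ b₂ ≡ overlapsᵇ b₁ b₂ a₁ a₂
overlapsᵇ-comm a₁ a₂ b₁ b₂ = Bool.∧-comm (a₁ <ᵇ b₂) (b₁ <ᵇ a₂)

overlapsᵇ⇔ : ∀ {a₁ a₂ b₁ b₂} →
  T (overlapsᵇ a₁ a₂ b₁ b₂) ⇔ (fromℕ a₁ ℚ.< fromℕ b₂ × fromℕ b₁ ℚ.< fromℕ a₂)
overlapsᵇ⇔ = ⇔.trans Bool.T-∧ (<ᵇ⇔< ×-⇔ <ᵇ⇔<)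
  where
  <ᵇ⇔< : ∀ {m n} → T (m <ᵇ n) ⇔ fromℕ m ℚ.< fromℕ n
  <ᵇ⇔< {m} {n} = ⇔.trans (mk⇔ (<ᵇ⇒< m n) <⇒<ᵇ) fromℕ-<⇔

unitOverlap⇒≡ : ∀ {a b} → T (overlapsᵇ a (suc a) b (suc b)) → a ≡ b
unitOverlap⇒≡ {a} {b} a~b with Equivalence.to Bool.T-∧ a~b
... | a<1+b , b<1+a =
  ≤-antisym (m<1+n⇒m≤n (<ᵇ⇒< a (suc b) a<1+b)) (m<1+n⇒m≤n (<ᵇ⇒< b (suc a) b<1+a))

record Box : Set where
  constructor [_,_]×[_,_]
  field
    left right bottom top : ℕ
open Box

WellFormed : Box → Set
WellFormed b = left b ℕ.< right b × bottom b ℕ.< top b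

module BoxVisibility (box : Fin n → Box) where

  xOverlapsᵇ yOverlapsᵇ visibleᵇ : Fin n → Fin n → Bool
  xOverlapsᵇ i j = overlapsᵇ (left (box i)) (right (box i)) (left (box j)) (right (box j))
  yOverlapsᵇ i j = overlapsᵇ (bottom (box i)) (top (box i)) (bottom (box j)) (top (box j))
  visibleᵇ   i j = yOverlapsᵇ i j ∨ xOverlapsᵇ i j

  xOverlapsᵇ-comm : ∀ i j → xOverlapsᵇ i j ≡ xOverlapsᵇ j i
  xOverlapsᵇ-comm i j = overlapsᵇ-comm (left (box i)) (right (box i)) (left (box j)) (right (box j))

  yOverlapsᵇ-comm : ∀ i j → yOverlapsᵇ i j ≡ yOverlapsᵇ j i
  yOverlapsᵇ-comm i j = overlapsᵇ-comm (bottom (box i)) (top (box i)) (bottom (box j)) (top (box j))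

  graph : Graph n
  graph = record
    { adj    = λ i j → does (¬? (i Fin.≟ j)) ∧ visibleᵇ i j
    ; sym    = λ i j → cong₂ _∧_ (cong not (does-⇔ (mk⇔ sym sym) (i Fin.≟ j) (j Fin.≟ i)))
                                 (cong₂ _∨_ (yOverlapsᵇ-comm i j) (xOverlapsᵇ-comm i j))
    ; irrefl = λ i → cong (λ b → not b ∧ visibleᵇ i i) (dec-true (i Fin.≟ i) refl)
    }

  module _ (wellFormed : ∀ i → WellFormed (box i)) where

    rect : Fin n → Rect
    rect i = record
      { x₁ = fromℕ (left (box i))   ; x₂ = fromℕ (right (box i))
      ; y₁ = fromℕ (bottom (box i)) ; y₂ = fromℕ (top (box i))
      ; x₁<x₂ = Equivalence.to fromℕ-<⇔ (proj₁ (wellFormed i))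
      ; y₁<y₂ = Equivalence.to fromℕ-<⇔ (proj₂ (wellFormed i))
      }

    isTRVG : (∀ i j → i ≢ j → ¬ (T (xOverlapsᵇ i j) × T (yOverlapsᵇ i j))) → IsTRVG graph
    isTRVG disjoint = rect , interiorDisjoint , adj⇔visible
      where
      interiorDisjoint : ∀ i j → i ≢ j → InteriorDisjoint (rect i) (rect j)
      interiorDisjoint i j i≢j (x-overlap , y-overlap) = disjoint i j i≢j
        (Equivalence.from overlapsᵇ⇔ x-overlap , Equivalence.from overlapsᵇ⇔ y-overlap)
      adj⇔visible : ∀ i j → i ≢ j → (adj graph i j ≡ true) ⇔ Visible (rect i) (rect j)
      adj⇔visible i j i≢j rewrite dec-false (i Fin.≟ j) i≢j =
        ⇔.trans (⇔.sym Bool.T-≡) (⇔.trans Bool.T-∨ (overlapsᵇ⇔ ⊎-⇔ overlapsᵇ⇔))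

∀-↑ : ∀ m {k} {P : Fin (m + k) → Set ℓ} → (∀ c → P (c ↑ˡ k)) → (∀ t → P (m ↑ʳ t)) → ∀ i → P i
∀-↑ zero    on↑ˡ on↑ʳ i       = on↑ʳ i
∀-↑ (suc m) on↑ˡ on↑ʳ zero    = on↑ˡ zero
∀-↑ (suc m) on↑ˡ on↑ʳ (suc i) = ∀-↑ m (on↑ˡ ∘ suc) on↑ʳ i

-- x-overlaps of the seven core boxes: 03 13 14 15 25 26; y-overlaps: 04 05 06 16 23 24.
-- Both are spanning trees, and they join the colour classes {0,1,2} and {3,4,5,6}. The
-- diagonal square t overlaps box 6 in x and box 3 in y, and nothing else.
module Extremal (k : ℕ) where

  pattern diag t = Fin.suc (Fin.suc (Fin.suc (Fin.suc (Fin.suc (Fin.suc (Fin.suc t))))))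

  box : Fin (7 + k) → Box
  box 0F       = [ 0 , 1 ]×[ 1 , 4 ]
  box 1F       = [ 1 , 4 ]×[ 0 , 1 ]
  box 2F       = [ 4 , 6 ]×[ 4 , 6 ]
  box 3F       = [ 0 , 2 ]×[ 5 , 6 + k ]
  box 4F       = [ 2 , 3 ]×[ 3 , 5 ]
  box 5F       = [ 3 , 5 ]×[ 2 , 3 ]
  box 6F       = [ 5 , 6 + k ]×[ 0 , 2 ]
  box (diag t) = [ 6 + toℕ t , 7 + toℕ t ]×[ 6 + toℕ t , 7 + toℕ t ]

  colour : Fin (7 + k) → Bool
  colour 3F = false
  colour 4F = false
  colour 5F = false
  colour 6F = false
  colour _  = true

  open BoxVisibility box

  wellFormed : ∀ i → WellFormed (box i)
  wellFormed = ∀-↑ 7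
    (from-yes (Fin.all? λ c → let b = box (c ↑ˡ k) in
                                left b ℕ.<? right b ×-dec bottom b ℕ.<? top b))
    (λ t → n<1+n (6 + toℕ t) , n<1+n (6 + toℕ t))

  diag-overlap⇒≡ : ∀ {t u} → T (xOverlapsᵇ (diag t) (diag u)) → t ≡ u
  diag-overlap⇒≡ = Fin.toℕ-injective ∘ unitOverlap⇒≡

  Disjoint : Fin (7 + k) → Fin (7 + k) → Set
  Disjoint i j = i ≢ j → ¬ (T (xOverlapsᵇ i j) × T (yOverlapsᵇ i j))

  -- Unlike the other cases this is not decided by evaluation: whether boxes 3 and 6 overlap
  -- square t depends on toℕ t <ᵇ k, which does not reduce for a variable t.
  core-diag-disjoint : ∀ c t → Disjoint (c ↑ˡ k) (diag t)
  core-diag-disjoint 0F t _ (() , _)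
  core-diag-disjoint 1F t _ (() , _)
  core-diag-disjoint 2F t _ (() , _)
  core-diag-disjoint 3F t _ (() , _)
  core-diag-disjoint 4F t _ (() , _)
  core-diag-disjoint 5F t _ (() , _)
  core-diag-disjoint 6F t _ (_ , ())

  disjoint : ∀ i j → Disjoint i j
  disjoint = ∀-↑ 7 (λ c → ∀-↑ 7 (core-core c) (core-diag-disjoint c))
                   (λ t → ∀-↑ 7 (diag-core t) (diag-diag t))
    where
    disjoint? : ∀ i j → Dec (Disjoint i j)
    disjoint? i j = ¬? (i Fin.≟ j) →-dec ¬? (T? (xOverlapsᵇ i j) ×-dec T? (yOverlapsᵇ i j))
    core-core : ∀ c d → Disjoint (c ↑ˡ k) (d ↑ˡ k)
    core-core = from-yes (Fin.all? λ c → Fin.all? λ d → disjoint? (c ↑ˡ k) (d ↑ˡ k))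
    diag-core : ∀ t c → Disjoint (diag t) (c ↑ˡ k)
    diag-core t c d≢c (x-overlap , y-overlap) = core-diag-disjoint c t (d≢c ∘ sym)
      ( subst T (xOverlapsᵇ-comm (diag t) (c ↑ˡ k)) x-overlap
      , subst T (yOverlapsᵇ-comm (diag t) (c ↑ˡ k)) y-overlap )
    diag-diag : ∀ t u → Disjoint (diag t) (diag u)
    diag-diag t u t≢u (x-overlap , _) = t≢u (cong (7 ↑ʳ_) (diag-overlap⇒≡ x-overlap))

  Proper : Fin (7 + k) → Fin (7 + k) → Set
  Proper i j = colour i ≡ colour j → ¬ T (adj graph i j)

  properColouring : ∀ i j → Proper i j
  properColouring = ∀-↑ 7 (λ c → ∀-↑ 7 (core-core c) (λ t → core-diag t c))
                          (λ t → ∀-↑ 7 (diag-core t) (diag-diag t))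
    where
    proper? : ∀ i j → Dec (Proper i j)
    proper? i j = colour i Bool.≟ colour j →-dec ¬? (T? (adj graph i j))
    core-core : ∀ c d → Proper (c ↑ˡ k) (d ↑ˡ k)
    core-core = from-yes (Fin.all? λ c → Fin.all? λ d → proper? (c ↑ˡ k) (d ↑ˡ k))
    core-diag : ∀ t c → Proper (c ↑ˡ k) (diag t)
    core-diag t = from-yes (Fin.all? λ c → proper? (c ↑ˡ k) (diag t))
    diag-core : ∀ t c → Proper (diag t) (c ↑ˡ k)
    diag-core t = from-yes (Fin.all? λ c → proper? (diag t) (c ↑ˡ k))
    diag-diag : ∀ t u → Proper (diag t) (diag u)
    diag-diag t u _ with t Fin.≟ u
    ... | yes _   = λ ()
    ... | no  t≢u =
      t≢u ∘ [ diag-overlap⇒≡ {t} {u} , diag-overlap⇒≡ {t} {u} ] ∘ Equivalence.to Bool.T-∨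

  bipartite : Bipartite graph
  bipartite = colour , λ i j ij same → properColouring i j same (Equivalence.from Bool.T-≡ ij)

  toℕ<ᵇk : (t : Fin k) → T (toℕ t <ᵇ k)
  toℕ<ᵇk = <⇒<ᵇ ∘ Fin.toℕ<n

  laterNeighbours : Fin (7 + k) → ℕ
  laterNeighbours 0F = 4
  laterNeighbours 1F = 4
  laterNeighbours 2F = 4
  laterNeighbours 3F = k
  laterNeighbours 6F = k
  laterNeighbours _  = 0

  laterNeighbours≤ : ∀ i → laterNeighbours i ≤ ∑[ j < 7 + k ] 𝟙 ((toℕ i <ᵇ toℕ j) ∧ adj graph i j)
  laterNeighbours≤ 0F       = m≤m+n 4 _
  laterNeighbours≤ 1F       = m≤m+n 4 _
  laterNeighbours≤ 2F       = m≤m+n 4 _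
  laterNeighbours≤ 3F       = ≤-reflexive (sym (∑𝟙≡n (λ t → T? ((toℕ t <ᵇ k) ∨ false))
                                (λ t → Equivalence.from Bool.T-∨ (inj₁ (toℕ<ᵇk t)))))
  laterNeighbours≤ 4F       = z≤n
  laterNeighbours≤ 5F       = z≤n
  laterNeighbours≤ 6F       = ≤-reflexive (sym (∑𝟙≡n (λ t → T? (false ∨ (toℕ t <ᵇ k)))
                                (λ t → Equivalence.from Bool.T-∨ (inj₂ (toℕ<ᵇk t)))))
  laterNeighbours≤ (diag t) = z≤n

  2n∸2≤edgeCount : 2 * (7 + k) ∸ 2 ≤ edgeCount graph
  2n∸2≤edgeCount = begin
    2 * (7 + k) ∸ 2                   ≡⟨ cong (_∸ 2) (*-distribˡ-+ 2 7 k) ⟩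
    12 + 2 * k                        ≡⟨ cong (λ z → 12 + (k + (k + z))) (sum-replicate-zero k) ⟨
    ∑[ i < 7 + k ] laterNeighbours i  ≤⟨ ∑-mono-≤ laterNeighbours≤ ⟩
    pairCount (λ i j → T? ((toℕ i <ᵇ toℕ j) ∧ adj graph i j))
                                      ≡⟨ edgeCount≡pairCount graph ⟨
    edgeCount graph                   ∎
    where open ≤-Reasoning

  witness : Σ (Graph (7 + k)) λ G → IsTRVG G × Bipartite G × edgeCount G ≡ 2 * (7 + k) ∸ 2
  witness = graph , trvg , bipartite
          , ≤-antisym (bipartiteTRVG-edgeCount≤ graph trvg bipartite) 2n∸2≤edgeCount
    where
    trvg : IsTRVG graph
    trvg = isTRVG wellFormed disjoint

extremal : ∀ n → 7 ≤ n → Σ (Graph n) λ G → IsTRVG G × Bipartite G × edgeCount G ≡ 2 * n ∸ 2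
extremal n 7≤n = subst (λ n → Σ (Graph n) λ G → IsTRVG G × Bipartite G × edgeCount G ≡ 2 * n ∸ 2)
                       (m+[n∸m]≡n 7≤n) (Extremal.witness (n ∸ 7))

theorem1p2 : ((n : ℕ) (G : Graph n) → IsTRVG G → Bipartite G → edgeCount G ≤ 2 * n ∸ 2)
             × ((n : ℕ) → 7 ≤ n →
                Σ (Graph n) λ G → IsTRVG G × Bipartite G × edgeCount G ≡ 2 * n ∸ 2)
theorem1p2 = (λ _ → bipartiteTRVG-edgeCount≤) , extremal
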